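{- For every integer $p \ge 0$ and every integer $n \ge 0$, $$\sum_{k=0}^n S(n,k)\,(-1)^k\, k!\, h_k^{(p)} = (-1)^n\, n\, p^{n-1}.$$ In particular, for $p=1$ (where $h_k^{(1)} = H_k$), $$\sum_{k=0}^n S(n,k)\,(-1)^k\, k!\, H_k = (-1)^n n.$$
   Context: $S(n,k)$ denotes the Stirling numbers of the second kind. $H_n = 1 + \tfrac12 + \dots + \tfrac1n$ are the harmonic numbers ($H_0=0$). For an integer $p\ge 0$, the hyperharmonic numbers $h_n^{(p)}$ are defined by the generating function $\frac{ -\ln(1-t)}{(1-t)^p} = \sum_{n=0}^\infty h_n^{(p)} t^n$ for $|t|<1$; equivalently, $h_n^{(1)}=H_n$, $h_n^{(p+1)} = h_1^{(p)}+\dots+h_n^{(p)}$, and $h_0^{(p)}=0$, and $h_n^{(p+1)} = \binom{n+p}{n}(H_{n+p}-H_p)$. On the right-hand side, $0^0=1$, and for $n=0$ the expression $n p^{n-1}$ is read as $0$. -}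

module Defs where

open import Data.Nat as ℕ using (ℕ; zero; suc)
open import Data.Rational as ℚ using (ℚ; _+_; _*_; -_; 0ℚ; 1ℚ)
open import Data.Integer as ℤ using (ℤ)

S : ℕ → ℕ → ℕ
S zero    zero    = 1
S zero    (suc k) = 0
S (suc n) zero    = 0
S (suc n) (suc k) = suc k ℕ.* S n (suc k) ℕ.+ S n k

ℕ→ℚ : ℕ → ℚ
ℕ→ℚ n = ℤ.+ n ℚ./ 1

sgn : ℕ → ℚ
sgn zero    = 1ℚ
sgn (suc k) = - sgn k

H : ℕ → ℚ
H zero    = 0ℚ
H (suc n) = H n + ℤ.+ 1 ℚ./ suc n

-- hyperharmonic numbers h_n^{(p)} (coefficients of -ln(1-t)/(1-t)^p):
-- h_n^{(0)} = 1/n (n ≥ 1), h_0^{(0)} = 0;  h_n^{(p+1)} = h_1^{(p)} + ... + h_n^{(p)}, h_0^{(p)} = 0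
h : ℕ → ℕ → ℚ
h zero    zero    = 0ℚ
h zero    (suc n) = ℤ.+ 1 ℚ./ suc n
h (suc p) zero    = 0ℚ
h (suc p) (suc n) = h (suc p) n + h p (suc n)

sumTo : ℕ → (ℕ → ℚ) → ℚ
sumTo zero    f = f 0
sumTo (suc n) f = sumTo n f + f (suc n)

-- Write T n f = Σₖ S(n,k) (-1)^k k! f(k).  The recurrence for S(n+1,k) turns
-- T (n+1) f into T n (Δ f) with Δ f k = k f(k) - (k+1) f(k+1); on generating
-- functions Δ is F ↦ -(1-t) F'.  For the coefficients m_p of (1-t)^(-p) and
-- h^(p) of -ln(1-t)/(1-t)^p this gives Δ m_p = -p m_p and Δ h^(p) = -p h^(p) - m_p,
-- so T n m_p = (-p)^n, and T n h^(p) obeys a first-order recurrence whose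
-- solution is (-1)^n n p^(n-1).
module Submission where

open import Defs
open import Data.Nat as ℕ using (ℕ; zero; suc; _∸_; _^_; _<_; s<s)
open import Data.Nat.Base using (_!)
import Data.Nat.Properties as ℕ
open import Algebra.Properties.CommutativeSemigroup ℕ.*-commutativeSemigroup using (x∙yz≈y∙xz)
open import Data.Nat.Coprimality as Coprimality using (Coprime)
import Data.Integer as ℤ
import Data.Integer.Properties as ℤ
open import Data.Rational as ℚ using (ℚ; mkℚ; _+_; _*_; -_; _-_; 0ℚ; 1ℚ)
open import Data.Rational.Properties
open import Data.Rational.Solver
open import Data.Product using (_×_; _,_)
open import Function using (_∘_)
open import Relation.Binary.PropositionalEquality
open ≡-Reasoning
open +-*-Solver

coprime-1 : ∀ n → Coprime n 1
coprime-1 n = Coprimality.sym (Coprimality.1-coprimeTo n)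

ℕ→ℚ≡mkℚ : ∀ n → ℕ→ℚ n ≡ mkℚ (ℤ.+ n) 0 (coprime-1 n)
ℕ→ℚ≡mkℚ n = normalize-coprime (coprime-1 n)

ℕ→ℚ-+ : ∀ m n → ℕ→ℚ (m ℕ.+ n) ≡ ℕ→ℚ m + ℕ→ℚ n
ℕ→ℚ-+ m n rewrite ℕ→ℚ≡mkℚ m | ℕ→ℚ≡mkℚ n =
  /-cong (trans (ℤ.pos-+ m n) (sym (cong₂ ℤ._+_ (ℤ.*-identityʳ (ℤ.+ m)) (ℤ.*-identityʳ (ℤ.+ n))))) refl

ℕ→ℚ-* : ∀ m n → ℕ→ℚ (m ℕ.* n) ≡ ℕ→ℚ m * ℕ→ℚ n
ℕ→ℚ-* m n rewrite ℕ→ℚ≡mkℚ m | ℕ→ℚ≡mkℚ n = /-cong (ℤ.pos-* m n) refl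

ℕ→ℚ-suc : ∀ n → ℕ→ℚ (suc n) ≡ 1ℚ + ℕ→ℚ n
ℕ→ℚ-suc = ℕ→ℚ-+ 1

ℕ→ℚ-suc-* : ∀ n x → ℕ→ℚ (suc n) * x ≡ x + ℕ→ℚ n * x
ℕ→ℚ-suc-* n x = begin
  ℕ→ℚ (suc n) * x     ≡⟨ cong (_* x) (ℕ→ℚ-suc n) ⟩
  (1ℚ + ℕ→ℚ n) * x    ≡⟨ solve 2 (λ n x → (con 1ℚ :+ n) :* x := x :+ n :* x) refl (ℕ→ℚ n) x ⟩
  x + ℕ→ℚ n * x       ∎

ℕ→ℚ-*-1/ : ∀ n → ℕ→ℚ (suc n) * (ℤ.+ 1 ℚ./ suc n) ≡ 1ℚ
ℕ→ℚ-*-1/ n rewrite ℕ→ℚ≡mkℚ (suc n) | normalize-coprime {1} {n} (Coprimality.1-coprimeTo (suc n)) =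
  *-inverseʳ (mkℚ (ℤ.+ suc n) 0 (coprime-1 (suc n)))

sumTo-cong : ∀ n {f g : ℕ → ℚ} → (∀ k → f k ≡ g k) → sumTo n f ≡ sumTo n g
sumTo-cong zero    f≗g = f≗g 0
sumTo-cong (suc n) f≗g = cong₂ _+_ (sumTo-cong n f≗g) (f≗g (suc n))

sumTo-+ : ∀ n (f g : ℕ → ℚ) → sumTo n (λ k → f k + g k) ≡ sumTo n f + sumTo n g
sumTo-+ zero    f g = refl
sumTo-+ (suc n) f g = trans (cong (_+ (f (suc n) + g (suc n))) (sumTo-+ n f g))
  (solve 4 (λ a b x y → (a :+ b) :+ (x :+ y) := (a :+ x) :+ (b :+ y)) refl
    (sumTo n f) (sumTo n g) (f (suc n)) (g (suc n)))

sumTo-- : ∀ n (f g : ℕ → ℚ) → sumTo n (λ k → f k - g k) ≡ sumTo n f - sumTo n g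
sumTo-- zero    f g = refl
sumTo-- (suc n) f g = trans (cong (_+ (f (suc n) - g (suc n))) (sumTo-- n f g))
  (solve 4 (λ a b x y → (a :- b) :+ (x :- y) := (a :+ x) :- (b :+ y)) refl
    (sumTo n f) (sumTo n g) (f (suc n)) (g (suc n)))

sumTo-* : ∀ n r (f : ℕ → ℚ) → sumTo n (λ k → r * f k) ≡ r * sumTo n f
sumTo-* zero    r f = refl
sumTo-* (suc n) r f = trans (cong (_+ (r * f (suc n))) (sumTo-* n r f))
  (sym (*-distribˡ-+ r (sumTo n f) (f (suc n))))

sumTo-suc : ∀ n (f : ℕ → ℚ) → sumTo (suc n) f ≡ f 0 + sumTo n (f ∘ suc)
sumTo-suc zero    f = refl
sumTo-suc (suc n) f = trans (cong (_+ f (suc (suc n))) (sumTo-suc n f))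
  (+-assoc (f 0) (sumTo n (f ∘ suc)) (f (suc (suc n))))

sumTo-∘suc : ∀ n (f : ℕ → ℚ) → f 0 ≡ 0ℚ → f (suc n) ≡ 0ℚ → sumTo n (f ∘ suc) ≡ sumTo n f
sumTo-∘suc n f f0≡0 fn+1≡0 = begin
  sumTo n (f ∘ suc)          ≡⟨ +-identityˡ _ ⟨
  0ℚ + sumTo n (f ∘ suc)     ≡⟨ cong (_+ sumTo n (f ∘ suc)) f0≡0 ⟨
  f 0 + sumTo n (f ∘ suc)    ≡⟨ sumTo-suc n f ⟨
  sumTo (suc n) f            ≡⟨ cong (sumTo n f +_) fn+1≡0 ⟩
  sumTo n f + 0ℚ             ≡⟨ +-identityʳ _ ⟩
  sumTo n f                  ∎

S-vanishes : ∀ {n k} → n < k → S n k ≡ 0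
S-vanishes {zero}  {suc k} _         = refl
S-vanishes {suc n} {suc k} (s<s n<k)
  rewrite S-vanishes {n} {suc k} (ℕ.m<n⇒m<1+n n<k) | S-vanishes n<k | ℕ.*-zeroʳ k = refl

stirlingWeight : ℕ → ℕ → ℚ
stirlingWeight n k = ℕ→ℚ (S n k) * sgn k * ℕ→ℚ (k !)

stirlingTransform : ℕ → (ℕ → ℚ) → ℚ
stirlingTransform n f = sumTo n (λ k → stirlingWeight n k * f k)

stirlingWeight-suc : ∀ n j →
  stirlingWeight (suc n) (suc j)
    ≡ ℕ→ℚ (suc j) * stirlingWeight n (suc j) - ℕ→ℚ (suc j) * stirlingWeight n j
stirlingWeight-suc n j = begin
  ℕ→ℚ (suc j ℕ.* S n (suc j) ℕ.+ S n j) * (- sgn j) * ℕ→ℚ (suc j ℕ.* j !)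
    ≡⟨ cong₂ (λ u v → u * (- sgn j) * v)
         (trans (ℕ→ℚ-+ (suc j ℕ.* S n (suc j)) (S n j)) (cong (_+ ℕ→ℚ (S n j)) (ℕ→ℚ-* (suc j) (S n (suc j)))))
         (ℕ→ℚ-* (suc j) (j !)) ⟩
  (J₁ * A + B) * (- s) * (J₁ * F)
    ≡⟨ solve 5 (λ J A B s F → (J :* A :+ B) :* (:- s) :* (J :* F)
                 := J :* (A :* (:- s) :* (J :* F)) :- J :* (B :* s :* F)) refl J₁ A B s F ⟩
  J₁ * (A * (- s) * (J₁ * F)) - J₁ * (B * s * F)
    ≡⟨ cong (λ v → J₁ * (A * (- s) * v) - J₁ * (B * s * F)) (ℕ→ℚ-* (suc j) (j !)) ⟨
  ℕ→ℚ (suc j) * stirlingWeight n (suc j) - ℕ→ℚ (suc j) * stirlingWeight n j ∎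
  where
  J₁ A B s F : ℚ
  J₁ = ℕ→ℚ (suc j)
  A = ℕ→ℚ (S n (suc j))
  B = ℕ→ℚ (S n j)
  s = sgn j
  F = ℕ→ℚ (j !)

Δ : (ℕ → ℚ) → ℕ → ℚ
Δ f k = ℕ→ℚ k * f k - ℕ→ℚ (suc k) * f (suc k)

stirlingTransform-suc : ∀ n f → stirlingTransform (suc n) f ≡ stirlingTransform n (Δ f)
stirlingTransform-suc n f = begin
  stirlingTransform (suc n) f
    ≡⟨ sumTo-suc n (λ k → stirlingWeight (suc n) k * f k) ⟩
  stirlingWeight (suc n) 0 * f 0 + sumTo n (λ j → stirlingWeight (suc n) (suc j) * f (suc j))
    ≡⟨ cong₂ _+_ (solve 3 (λ s F x → con 0ℚ :* s :* F :* x := con 0ℚ) refl 1ℚ 1ℚ (f 0))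
                 (sumTo-cong n split) ⟩
  0ℚ + sumTo n (λ j → G (suc j) - V j)
    ≡⟨ +-identityˡ _ ⟩
  sumTo n (λ j → G (suc j) - V j)
    ≡⟨ sumTo-- n (G ∘ suc) V ⟩
  sumTo n (G ∘ suc) - sumTo n V
    ≡⟨ cong (_- sumTo n V) (sumTo-∘suc n G G0≡0 Gn+1≡0) ⟩
  sumTo n G - sumTo n V
    ≡⟨ sumTo-- n G V ⟨
  sumTo n (λ k → G k - V k)
    ≡⟨ sumTo-cong n (λ k → solve 4 (λ w K L M → w :* K :- w :* (L :* M) := w :* (K :- L :* M)) refl
                              (stirlingWeight n k) (ℕ→ℚ k * f k) (ℕ→ℚ (suc k)) (f (suc k))) ⟩
  stirlingTransform n (Δ f) ∎
  where
  G V : ℕ → ℚ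
  G k = stirlingWeight n k * (ℕ→ℚ k * f k)
  V k = stirlingWeight n k * (ℕ→ℚ (suc k) * f (suc k))

  split : ∀ j → stirlingWeight (suc n) (suc j) * f (suc j) ≡ G (suc j) - V j
  split j = trans (cong (_* f (suc j)) (stirlingWeight-suc n j))
    (solve 4 (λ J a b x → (J :* a :- J :* b) :* x := a :* (J :* x) :- b :* (J :* x)) refl
      (ℕ→ℚ (suc j)) (stirlingWeight n (suc j)) (stirlingWeight n j) (f (suc j)))

  G0≡0 : G 0 ≡ 0ℚ
  G0≡0 = solve 2 (λ w x → w :* (con 0ℚ :* x) := con 0ℚ) refl (stirlingWeight n 0) (f 0)

  Gn+1≡0 : G (suc n) ≡ 0ℚ
  Gn+1≡0 rewrite S-vanishes (ℕ.n<1+n n) =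
    solve 3 (λ s F y → con 0ℚ :* s :* F :* y := con 0ℚ) refl
      (sgn (suc n)) (ℕ→ℚ (suc n !)) (ℕ→ℚ (suc n) * f (suc n))

stirlingTransform-cong : ∀ n {f g : ℕ → ℚ} → (∀ k → f k ≡ g k) →
  stirlingTransform n f ≡ stirlingTransform n g
stirlingTransform-cong n f≗g = sumTo-cong n (λ k → cong (stirlingWeight n k *_) (f≗g k))

stirlingTransform-+ : ∀ n (f g : ℕ → ℚ) →
  stirlingTransform n (λ k → f k + g k) ≡ stirlingTransform n f + stirlingTransform n g
stirlingTransform-+ n f g = trans
  (sumTo-cong n (λ k → *-distribˡ-+ (stirlingWeight n k) (f k) (g k)))
  (sumTo-+ n _ _)

stirlingTransform-* : ∀ n r (f : ℕ → ℚ) →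
  stirlingTransform n (λ k → r * f k) ≡ r * stirlingTransform n f
stirlingTransform-* n r f = trans
  (sumTo-cong n (λ k → solve 3 (λ w r x → w :* (r :* x) := r :* (w :* x)) refl (stirlingWeight n k) r (f k)))
  (sumTo-* n r _)

PascalRule : (ℕ → ℕ → ℚ) → Set
PascalRule f = ∀ p k → f (suc p) (suc k) ≡ f (suc p) k + f p (suc k)

Absorption : (f g : ℕ → ℕ → ℚ) → ℕ → ℕ → Set
Absorption f g p k = ℕ→ℚ (suc k) * f p (suc k) ≡ (ℕ→ℚ k + ℕ→ℚ p) * f p k + g p k

-- The step at (p+1, k+1) is the sum of the identities at (p+1, k) and (p, k+1).
absorption : ∀ {f g} → PascalRule f → PascalRule g →
  (∀ k → Absorption f g 0 k) → (∀ p → Absorption f g (suc p) 0) →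
  ∀ p k → Absorption f g p k
absorption pascal-f pascal-g absorb₀ absorbₛ zero    k       = absorb₀ k
absorption pascal-f pascal-g absorb₀ absorbₛ (suc p) zero    = absorbₛ p
absorption {f} {g} pascal-f pascal-g absorb₀ absorbₛ (suc p) (suc k) = begin
  K₂ * f (suc p) (suc (suc k))
    ≡⟨ cong (K₂ *_) (pascal-f p (suc k)) ⟩
  K₂ * (Y + Z)
    ≡⟨ *-distribˡ-+ K₂ Y Z ⟩
  K₂ * Y + K₂ * Z
    ≡⟨ cong₂ _+_ (ℕ→ℚ-suc-* (suc k) Y) (IH p (suc k)) ⟩
  (Y + K₁ * Y) + ((K₁ + P) * B + g p (suc k))
    ≡⟨ cong₂ (λ u v → (u + v) + ((K₁ + P) * B + g p (suc k))) (pascal-f p k) (IH (suc p) k) ⟩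
  ((A + B) + ((K + P₁) * A + g (suc p) k)) + ((K₁ + P) * B + g p (suc k))
    ≡⟨ solve 8 (λ A B K P K₁ P₁ x y →
           ((A :+ B) :+ ((K :+ P₁) :* A :+ x)) :+ ((K₁ :+ P) :* B :+ y)
           := ((con 1ℚ :+ K) :+ P₁) :* A :+ (K₁ :+ (con 1ℚ :+ P)) :* B :+ (x :+ y))
         refl A B K P K₁ P₁ (g (suc p) k) (g p (suc k)) ⟩
  ((1ℚ + K) + P₁) * A + (K₁ + (1ℚ + P)) * B + (g (suc p) k + g p (suc k))
    ≡⟨ cong₂ (λ u v → (u + P₁) * A + (K₁ + v) * B + (g (suc p) k + g p (suc k)))
         (ℕ→ℚ-suc k) (ℕ→ℚ-suc p) ⟨
  (K₁ + P₁) * A + (K₁ + P₁) * B + (g (suc p) k + g p (suc k))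
    ≡⟨ cong (_+ (g (suc p) k + g p (suc k))) (*-distribˡ-+ (K₁ + P₁) A B) ⟨
  (K₁ + P₁) * (A + B) + (g (suc p) k + g p (suc k))
    ≡⟨ cong₂ (λ u v → (K₁ + P₁) * u + v) (pascal-f p k) (pascal-g p k) ⟨
  (K₁ + P₁) * f (suc p) (suc k) + g (suc p) (suc k) ∎
  where
  IH : ∀ p k → Absorption f g p k
  IH = absorption pascal-f pascal-g absorb₀ absorbₛ
  K K₁ K₂ P P₁ A B Y Z : ℚ
  K = ℕ→ℚ k
  K₁ = ℕ→ℚ (suc k)
  K₂ = ℕ→ℚ (suc (suc k))
  P = ℕ→ℚ p
  P₁ = ℕ→ℚ (suc p)
  A = f (suc p) k
  B = f p (suc k)
  Y = f (suc p) (suc k)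
  Z = f p (suc (suc k))

-- The coefficient of t^k in (1-t)^(-p), that is, the binomial coefficient C(p+k-1, k).
multichoose : ℕ → ℕ → ℚ
multichoose p       zero    = 1ℚ
multichoose zero    (suc k) = 0ℚ
multichoose (suc p) (suc k) = multichoose (suc p) k + multichoose p (suc k)

multichoose-one : ∀ p → multichoose p 1 ≡ ℕ→ℚ p
multichoose-one zero    = refl
multichoose-one (suc p) = trans (cong (1ℚ +_) (multichoose-one p)) (sym (ℕ→ℚ-suc p))

multichoose-absorption : ∀ p k → Absorption multichoose (λ _ _ → 0ℚ) p k
multichoose-absorption = absorption (λ _ _ → refl) (λ _ _ → sym (+-identityʳ 0ℚ)) boundary₀ boundaryₛ
  where
  boundary₀ : ∀ k → Absorption multichoose (λ _ _ → 0ℚ) 0 k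
  boundary₀ zero    = refl
  boundary₀ (suc k) = solve 2 (λ K₂ K₁ → K₂ :* con 0ℚ := (K₁ :+ con 0ℚ) :* con 0ℚ :+ con 0ℚ) refl
    (ℕ→ℚ (suc (suc k))) (ℕ→ℚ (suc k))
  boundaryₛ : ∀ p → Absorption multichoose (λ _ _ → 0ℚ) (suc p) 0
  boundaryₛ p = begin
    1ℚ * (1ℚ + multichoose p 1)   ≡⟨ cong (λ m → 1ℚ * (1ℚ + m)) (multichoose-one p) ⟩
    1ℚ * (1ℚ + ℕ→ℚ p)             ≡⟨ solve 1 (λ P → con 1ℚ :* (con 1ℚ :+ P) := (con 0ℚ :+ (con 1ℚ :+ P)) :* con 1ℚ :+ con 0ℚ) refl (ℕ→ℚ p) ⟩
    (0ℚ + (1ℚ + ℕ→ℚ p)) * 1ℚ + 0ℚ ≡⟨ cong (λ P → (0ℚ + P) * 1ℚ + 0ℚ) (ℕ→ℚ-suc p) ⟨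
    (0ℚ + ℕ→ℚ (suc p)) * 1ℚ + 0ℚ  ∎

h-zero : ∀ p → h p 0 ≡ 0ℚ
h-zero zero    = refl
h-zero (suc p) = refl

h-one : ∀ p → h p 1 ≡ 1ℚ
h-one zero    = refl
h-one (suc p) = trans (+-identityˡ (h p 1)) (h-one p)

h-absorption : ∀ p k → Absorption h multichoose p k
h-absorption = absorption (λ _ _ → refl) (λ _ _ → refl) boundary₀ boundaryₛ
  where
  boundary₀ : ∀ k → Absorption h multichoose 0 k
  boundary₀ zero    = refl
  boundary₀ (suc k) = begin
    ℕ→ℚ (suc (suc k)) * (ℤ.+ 1 ℚ./ suc (suc k))     ≡⟨ ℕ→ℚ-*-1/ (suc k) ⟩
    1ℚ                                              ≡⟨ ℕ→ℚ-*-1/ k ⟨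
    ℕ→ℚ (suc k) * (ℤ.+ 1 ℚ./ suc k)                 ≡⟨ solve 2 (λ K x → K :* x := (K :+ con 0ℚ) :* x :+ con 0ℚ) refl
                                                         (ℕ→ℚ (suc k)) (ℤ.+ 1 ℚ./ suc k) ⟩
    (ℕ→ℚ (suc k) + 0ℚ) * (ℤ.+ 1 ℚ./ suc k) + 0ℚ      ∎
  boundaryₛ : ∀ p → Absorption h multichoose (suc p) 0
  boundaryₛ p = begin
    1ℚ * (0ℚ + h p 1)                 ≡⟨ cong (λ x → 1ℚ * (0ℚ + x)) (h-one p) ⟩
    1ℚ * (0ℚ + 1ℚ)                    ≡⟨ solve 1 (λ P → con 1ℚ :* (con 0ℚ :+ con 1ℚ) := (con 0ℚ :+ P) :* con 0ℚ :+ con 1ℚ) refl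
                                           (ℕ→ℚ (suc p)) ⟩
    (0ℚ + ℕ→ℚ (suc p)) * 0ℚ + 1ℚ      ∎

Δ-multichoose : ∀ p k → Δ (multichoose p) k ≡ - ℕ→ℚ p * multichoose p k
Δ-multichoose p k = trans (cong (_-_ (ℕ→ℚ k * multichoose p k)) (multichoose-absorption p k))
  (solve 3 (λ K P m → K :* m :- ((K :+ P) :* m :+ con 0ℚ) := (:- P) :* m) refl
    (ℕ→ℚ k) (ℕ→ℚ p) (multichoose p k))

Δ-h : ∀ p k → Δ (h p) k ≡ - ℕ→ℚ p * h p k + - 1ℚ * multichoose p k
Δ-h p k = trans (cong (_-_ (ℕ→ℚ k * h p k)) (h-absorption p k))
  (solve 4 (λ K P x m → K :* x :- ((K :+ P) :* x :+ m) := (:- P) :* x :+ (con (- 1ℚ)) :* m) refl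
    (ℕ→ℚ k) (ℕ→ℚ p) (h p k) (multichoose p k))

stirlingTransform-multichoose : ∀ p n → stirlingTransform n (multichoose p) ≡ sgn n * ℕ→ℚ (p ^ n)
stirlingTransform-multichoose p zero    = refl
stirlingTransform-multichoose p (suc n) = begin
  stirlingTransform (suc n) (multichoose p)
    ≡⟨ stirlingTransform-suc n (multichoose p) ⟩
  stirlingTransform n (Δ (multichoose p))
    ≡⟨ stirlingTransform-cong n (Δ-multichoose p) ⟩
  stirlingTransform n (λ k → - ℕ→ℚ p * multichoose p k)
    ≡⟨ stirlingTransform-* n (- ℕ→ℚ p) (multichoose p) ⟩
  - ℕ→ℚ p * stirlingTransform n (multichoose p)
    ≡⟨ cong (- ℕ→ℚ p *_) (stirlingTransform-multichoose p n) ⟩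
  - ℕ→ℚ p * (sgn n * ℕ→ℚ (p ^ n))
    ≡⟨ solve 3 (λ P s x → (:- P) :* (s :* x) := (:- s) :* (P :* x)) refl (ℕ→ℚ p) (sgn n) (ℕ→ℚ (p ^ n)) ⟩
  - sgn n * (ℕ→ℚ p * ℕ→ℚ (p ^ n))
    ≡⟨ cong (- sgn n *_) (ℕ→ℚ-* p (p ^ n)) ⟨
  sgn (suc n) * ℕ→ℚ (p ^ suc n) ∎

n*p^n≡p*[n*p^[n∸1]] : ∀ p n → n ℕ.* p ^ n ≡ p ℕ.* (n ℕ.* p ^ (n ∸ 1))
n*p^n≡p*[n*p^[n∸1]] p zero    = sym (ℕ.*-zeroʳ p)
n*p^n≡p*[n*p^[n∸1]] p (suc n) = x∙yz≈y∙xz (suc n) p (p ^ n)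

stirlingTransform-h : ∀ p n → stirlingTransform n (h p) ≡ sgn n * ℕ→ℚ (n ℕ.* p ^ (n ∸ 1))
stirlingTransform-h p zero    rewrite h-zero p = refl
stirlingTransform-h p (suc n) = begin
  stirlingTransform (suc n) (h p)
    ≡⟨ stirlingTransform-suc n (h p) ⟩
  stirlingTransform n (Δ (h p))
    ≡⟨ stirlingTransform-cong n (Δ-h p) ⟩
  stirlingTransform n (λ k → - P * h p k + - 1ℚ * multichoose p k)
    ≡⟨ stirlingTransform-+ n (λ k → - P * h p k) (λ k → - 1ℚ * multichoose p k) ⟩
  stirlingTransform n (λ k → - P * h p k) + stirlingTransform n (λ k → - 1ℚ * multichoose p k)
    ≡⟨ cong₂ _+_ (stirlingTransform-* n (- P) (h p)) (stirlingTransform-* n (- 1ℚ) (multichoose p)) ⟩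
  - P * stirlingTransform n (h p) + - 1ℚ * stirlingTransform n (multichoose p)
    ≡⟨ cong₂ (λ u v → - P * u + - 1ℚ * v) (stirlingTransform-h p n) (stirlingTransform-multichoose p n) ⟩
  - P * (sgn n * W) + - 1ℚ * (sgn n * X)
    ≡⟨ solve 4 (λ P s W X → (:- P) :* (s :* W) :+ (con (- 1ℚ)) :* (s :* X) := (:- s) :* (X :+ P :* W))
         refl P (sgn n) W X ⟩
  - sgn n * (X + P * W)
    ≡⟨ cong (- sgn n *_) coefficient ⟨
  sgn (suc n) * ℕ→ℚ (suc n ℕ.* p ^ n) ∎
  where
  P W X : ℚ
  P = ℕ→ℚ p
  W = ℕ→ℚ (n ℕ.* p ^ (n ∸ 1))
  X = ℕ→ℚ (p ^ n)
  coefficient : ℕ→ℚ (suc n ℕ.* p ^ n) ≡ X + P * W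
  coefficient = trans (ℕ→ℚ-+ (p ^ n) (n ℕ.* p ^ n))
    (cong (X +_) (trans (cong ℕ→ℚ (n*p^n≡p*[n*p^[n∸1]] p n)) (ℕ→ℚ-* p _)))

H≡h1 : ∀ k → H k ≡ h 1 k
H≡h1 zero    = refl
H≡h1 (suc k) = cong (_+ (ℤ.+ 1 ℚ./ suc k)) (H≡h1 k)

theorem1 : (p n : ℕ) →
    (sumTo n (λ k → ℕ→ℚ (S n k) * sgn k * ℕ→ℚ (k !) * h p k)
      ≡ sgn n * ℕ→ℚ (n ℕ.* p ^ (n ∸ 1)))
    × (sumTo n (λ k → ℕ→ℚ (S n k) * sgn k * ℕ→ℚ (k !) * H k)
      ≡ sgn n * ℕ→ℚ n)
theorem1 p n = stirlingTransform-h p n , harmonic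
  where
  harmonic : stirlingTransform n H ≡ sgn n * ℕ→ℚ n
  harmonic = begin
    stirlingTransform n H                    ≡⟨ stirlingTransform-cong n H≡h1 ⟩
    stirlingTransform n (h 1)                ≡⟨ stirlingTransform-h 1 n ⟩
    sgn n * ℕ→ℚ (n ℕ.* 1 ^ (n ∸ 1))          ≡⟨ cong (λ e → sgn n * ℕ→ℚ (n ℕ.* e)) (ℕ.^-zeroˡ (n ∸ 1)) ⟩
    sgn n * ℕ→ℚ (n ℕ.* 1)                    ≡⟨ cong (λ m → sgn n * ℕ→ℚ m) (ℕ.*-identityʳ n) ⟩
    sgn n * ℕ→ℚ n                            ∎
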